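{- Let $m \ge 4$ be an integer and let $\phi=(\Phi_1,\Phi_2,\dots,\Phi_m)$ be an $m$-clique hole (as defined in the context). Then $\phi$ is $m$-colorable if and only if $$\sum_{i=1}^{m} |\Phi_i \cap \Phi_{i+1}| \le m\left\lfloor \frac{m}{2}\right\rfloor ,$$ where indices are taken cyclically modulo $m$ (so $\Phi_{m+1}=\Phi_1$).
   Context: Indices are taken cyclically modulo $m$ throughout. An $m$-clique hole is a sequence $\phi=(\Phi_1,\dots,\Phi_m)$ of $m$ distinct nonempty finite vertex sets (cliques) such that $|\Phi_i|\le m$ for all $i$, and for all $i\neq j$ one has $\Phi_i\cap\Phi_j\neq\emptyset$ if and only if $j\equiv i+1$ or $j\equiv i-1 \pmod m$; equivalently, the intersection graph of the $\Phi_i$ is a chordless cycle on $m$ vertices. The graph of $\phi$ has vertex set $\Phi_1\cup\dots\cup\Phi_m$, two distinct vertices being adjacent if and only if they lie in a common $\Phi_i$ (so each $\Phi_i$ is a clique). $\phi$ is called $m$-colorable if the vertices of this graph can be colored with $m$ colors so that no two adjacent vertices receive the same color. -}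

module Defs where

open import Data.Nat using (ℕ; zero; suc; _≤_; _+_; _*_)
open import Data.Nat.DivMod using (_/_; _%_; m%n<n)
open import Data.Fin using (Fin; toℕ; fromℕ<)
open import Data.Fin.Subset using (Subset; _∈_; _∩_; ∣_∣; Nonempty)
open import Data.List using (map; allFin)
open import Data.Nat.ListAction using (sum)
open import Data.Product using (_×_; Σ)
open import Data.Sum using (_⊎_)
open import Relation.Nullary using (¬_)
open import Relation.Binary.PropositionalEquality using (_≡_)
open import Function.Bundles using (_⇔_)

next : ∀ {m} → Fin m → Fin m
next {suc k} i = fromℕ< (m%n<n (suc (toℕ i)) (suc k))

Cliques : ℕ → ℕ → Set
Cliques m n = Fin m → Subset n

IsCliqueHole : ∀ m {n} → Cliques m n → Set
IsCliqueHole m φ =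
    (∀ i j → φ i ≡ φ j → i ≡ j)
  × (∀ i → Nonempty (φ i))
  × (∀ i → ∣ φ i ∣ ≤ m)
  × (∀ i j → ¬ i ≡ j → (Nonempty (φ i ∩ φ j) ⇔ (j ≡ next i ⊎ i ≡ next j)))

InGraph : ∀ {m n} → Cliques m n → Fin n → Set
InGraph {m} φ v = Σ (Fin m) λ i → v ∈ φ i

Adjacent : ∀ {m n} → Cliques m n → Fin n → Fin n → Set
Adjacent {m} φ u v = ¬ u ≡ v × Σ (Fin m) λ i → (u ∈ φ i × v ∈ φ i)

Colorable : ∀ {m n} → ℕ → Cliques m n → Set
Colorable {m} {n} k φ =
  Σ ((v : Fin n) → InGraph φ v → Fin k) λ c →
    ∀ u v (pu : InGraph φ u) (pv : InGraph φ v) → Adjacent φ u v → ¬ c u pu ≡ c v pv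

intersectionSum : ∀ {m n} → Cliques m n → ℕ
intersectionSum {m} φ = sum (map (λ i → ∣ φ i ∩ φ (next i) ∣) (allFin m))

-- Write Sₖ = Φₖ ∩ Φₖ₊₁ and aₖ = |Sₖ|. As m ≥ 4, Φₖ and Φₖ₊₂ are disjoint, so the Sₖ are pairwise
-- disjoint and Sₖ, Sₖ₊₁ are disjoint parts of the clique Φₖ₊₁; in particular aₖ + aₖ₊₁ ≤ m.
--
-- Necessity: a colour class meets Sₖ ∪ Sₖ₊₁ ⊆ Φₖ₊₁ at most once, so going around the cycle it
-- meets at most ⌊m/2⌋ of the sets Sₖ; summing over the m colours gives Σ aₖ ≤ m⌊m/2⌋.
--
-- Sufficiency: regard the colours as ℤ/m and give Sₖ an arc of aₖ consecutive colours, the arc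
-- of Sₖ₊₁ starting dₖ colours after that of Sₖ with aₖ ≤ dₖ ≤ m − aₖ₊₁, so that the two arcs
-- inside Φₖ₊₁ are disjoint. The other vertices of a clique lie in no other clique and take the
-- colours outside its two arcs, which suffice because the clique has at most m vertices. Arc
-- starts whose successive differences satisfy these bounds and which close up modulo m exist as
-- soon as Σ aₖ ≤ m⌊m/2⌋: take the pointwise minimum of the loosest placement, whose total
-- length is at least m⌊m/2⌋, and of the tightest one shifted to end exactly at m⌊m/2⌋.

module Submission where

open import Defs
open import Data.Nat using (ℕ; zero; suc; _+_; _*_; _∸_; _⊓_; _≤_; _<_; _<?_; z≤n; s≤s; NonZero)
open import Data.Nat.Properties hiding (_≟_)
open import Data.Nat.DivMod
  using (_%_; _/_; _mod_; m≡m%n+[m/n]*n; %-distribˡ-+; m%n%n≡m%n; m<n⇒m%n≡m; n%n≡0; m*n%n≡0;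
         m*n/n≡m; /-monoˡ-≤; m/n*n≤m)
open import Data.Nat.Divisibility using (_∣_; divides; ∣m+n∣m⇒∣n; n∣m*n; ∣⇒≤)
open import Data.Nat.ListAction as ListAction using ()
open import Data.Fin using (Fin; toℕ; fromℕ; inject₁) renaming (zero to fzero; suc to fsuc)
open import Data.Fin.Properties
  using (_≟_; any?; toℕ-injective; toℕ-fromℕ<; toℕ<n; toℕ-fromℕ; toℕ-inject₁)
  renaming (suc-injective to fsuc-injective)
open import Data.Fin.Subset
  using (Subset; _∈_; _∉_; _⊆_; _∩_; _∪_; ∁; ∣_∣; inside; outside; Nonempty)
open import Data.Fin.Subset.Properties
  using (_∈?_; x∈p∩q⁺; x∈p∩q⁻; p∩q⊆p; p∩q⊆q; x∈p∪q⁺; x∈p∪q⁻; x∈∁p⇒x∉p; x∉p⇒x∈∁p;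
         p⊆q⇒∣p∣≤∣q∣; Empty-unique; ∣⊥∣≡0)
open import Data.List using (map; tabulate)
open import Data.Vec as Vec using ([]; _∷_; here; there)
open import Data.Vec.Properties using ([]=⇒lookup; lookup∘tabulate)
open import Data.Bool using (true)
open import Data.Product using (Σ; _×_; _,_; proj₁; proj₂)
open import Data.Sum as Sum using (_⊎_; inj₁; inj₂; [_,_]′)
open import Data.Empty using (⊥-elim)
open import Function.Bundles using (Equivalence; _⇔_; mk⇔)
open import Algebra.Properties.CommutativeMonoid.Sum +-0-commutativeMonoid
  using (sum-syntax; sum-init-last; sum-cong-≗; ∑-distrib-+; ∑-comm)
open import Algebra.Properties.CommutativeSemigroup +-commutativeSemigroup using (xy∙z≈xz∙y)
open import Relation.Nullary using (¬_; Dec; yes; no; does; contradiction)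
open import Relation.Binary.PropositionalEquality hiding ([_])

-- Counting in finite sums and subsets

∑-mono-≤ : ∀ {n} {f g : Fin n → ℕ} → (∀ i → f i ≤ g i) →
           ∑[ i < n ] f i ≤ ∑[ i < n ] g i
∑-mono-≤ {zero}  f≤g = z≤n
∑-mono-≤ {suc n} f≤g = +-mono-≤ (f≤g fzero) (∑-mono-≤ (λ i → f≤g (fsuc i)))

∑-const : ∀ n c → ∑[ i < n ] c ≡ n * c
∑-const zero    c = refl
∑-const (suc n) c = cong (c +_) (∑-const n c)

sum-map-tabulate : ∀ {k n} (f : Fin n → ℕ) (g : Fin k → Fin n) →
                   ListAction.sum (map f (tabulate g)) ≡ ∑[ i < k ] f (g i)
sum-map-tabulate {zero}  f g = refl
sum-map-tabulate {suc k} f g = cong (f (g fzero) +_) (sum-map-tabulate f (λ i → g (fsuc i)))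

∣p∪q∣≡∣p∣+∣q∣ : ∀ {n} {p q : Subset n} → (∀ {x} → x ∈ p → x ∉ q) →
                ∣ p ∪ q ∣ ≡ ∣ p ∣ + ∣ q ∣
∣p∪q∣≡∣p∣+∣q∣ {p = []}          {[]}          _ = refl
∣p∪q∣≡∣p∣+∣q∣ {p = inside  ∷ p} {inside  ∷ q} p∩q=∅ = ⊥-elim (p∩q=∅ here here)
∣p∪q∣≡∣p∣+∣q∣ {p = inside  ∷ p} {outside ∷ q} p∩q=∅ =
  cong suc (∣p∪q∣≡∣p∣+∣q∣ (λ x∈p x∈q → p∩q=∅ (there x∈p) (there x∈q)))
∣p∪q∣≡∣p∣+∣q∣ {p = outside ∷ p} {inside  ∷ q} p∩q=∅ =
  trans (cong suc (∣p∪q∣≡∣p∣+∣q∣ (λ x∈p x∈q → p∩q=∅ (there x∈p) (there x∈q))))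
        (sym (+-suc ∣ p ∣ ∣ q ∣))
∣p∪q∣≡∣p∣+∣q∣ {p = outside ∷ p} {outside ∷ q} p∩q=∅ =
  ∣p∪q∣≡∣p∣+∣q∣ (λ x∈p x∈q → p∩q=∅ (there x∈p) (there x∈q))

∣p∣+∣q∣≤∣r∣ : ∀ {n} {p q r : Subset n} → (∀ {x} → x ∈ p → x ∉ q) → p ⊆ r → q ⊆ r →
              ∣ p ∣ + ∣ q ∣ ≤ ∣ r ∣
∣p∣+∣q∣≤∣r∣ {p = p} {q} {r} p∩q=∅ p⊆r q⊆r = begin
  ∣ p ∣ + ∣ q ∣ ≡⟨ ∣p∪q∣≡∣p∣+∣q∣ p∩q=∅ ⟨
  ∣ p ∪ q ∣     ≤⟨ p⊆q⇒∣p∣≤∣q∣ (λ x∈p∪q → [ p⊆r , q⊆r ]′ (x∈p∪q⁻ p q x∈p∪q)) ⟩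
  ∣ r ∣         ∎
  where open ≤-Reasoning

∣p∣≤1 : ∀ {n} {p : Subset n} → (∀ {x y} → x ∈ p → y ∈ p → x ≡ y) → ∣ p ∣ ≤ 1
∣p∣≤1 {p = []}          _ = z≤n
∣p∣≤1 {p = outside ∷ p} single =
  ∣p∣≤1 (λ x∈p y∈p → fsuc-injective (single (there x∈p) (there y∈p)))
∣p∣≤1 {n = suc n} {p = inside  ∷ p} single =
  s≤s (≤-reflexive (trans (cong ∣_∣ (Empty-unique p=∅)) (∣⊥∣≡0 n)))
  where
  p=∅ : ¬ Nonempty p
  p=∅ (x , x∈p) with () ← single here (there x∈p)

∩-monoˡ-⊆ : ∀ {n} {p q : Subset n} (r : Subset n) → p ⊆ q → p ∩ r ⊆ q ∩ r
∩-monoˡ-⊆ {p = p} r p⊆q x∈p∩r with x∈p∩q⁻ p r x∈p∩r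
... | x∈p , x∈r = x∈p∩q⁺ (p⊆q x∈p , x∈r)

rank : ∀ {n} → Subset n → Fin n → ℕ
rank (_       ∷ p) fzero    = 0
rank (inside  ∷ p) (fsuc x) = suc (rank p x)
rank (outside ∷ p) (fsuc x) = rank p x

rank-< : ∀ {n} {p : Subset n} {x} → x ∈ p → rank p x < ∣ p ∣
rank-< here = s≤s z≤n
rank-< {p = inside  ∷ p} (there x∈p) = s≤s (rank-< x∈p)
rank-< {p = outside ∷ p} (there x∈p) = rank-< x∈p

rank-injective : ∀ {n} {p : Subset n} {x y} → x ∈ p → y ∈ p → rank p x ≡ rank p y → x ≡ y
rank-injective here here _ = refl
rank-injective {p = inside ∷ p} here      (there _) ()
rank-injective {p = inside ∷ p} (there _) here      ()
rank-injective {p = inside  ∷ p} (there x∈p) (there y∈p) eq =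
  cong fsuc (rank-injective x∈p y∈p (suc-injective eq))
rank-injective {p = outside ∷ p} (there x∈p) (there y∈p) eq =
  cong fsuc (rank-injective x∈p y∈p eq)

fibre : ∀ {n m} → (Fin n → Fin m) → Fin m → Subset n
fibre g c = Vec.tabulate (λ x → does (g x ≟ c))

∈fibre⁻ : ∀ {n m} {g : Fin n → Fin m} {x c} → x ∈ fibre g c → g x ≡ c
∈fibre⁻ {g = g} {x} {c} x∈ =
  from-does (g x ≟ c) (trans (sym (lookup∘tabulate _ x)) ([]=⇒lookup x∈))
  where
  from-does : ∀ {A : Set} (a? : Dec A) → does a? ≡ true → A
  from-does (yes a) _ = a

∑-∣does∷∣ : ∀ {m n} (x : Fin m) (q : Fin m → Subset n) →
            ∑[ c < m ] ∣ does (x ≟ c) ∷ q c ∣ ≡ suc (∑[ c < m ] ∣ q c ∣)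
∑-∣does∷∣ fzero    q = refl
∑-∣does∷∣ (fsuc x) q =
  trans (cong (∣ q fzero ∣ +_) (∑-∣does∷∣ x (λ c → q (fsuc c)))) (+-suc ∣ q fzero ∣ _)

∑-∣p∩fibre∣ : ∀ {n m} (g : Fin n → Fin m) (p : Subset n) →
              ∑[ c < m ] ∣ p ∩ fibre g c ∣ ≡ ∣ p ∣
∑-∣p∩fibre∣ {m = m} g []    = trans (∑-const m 0) (*-zeroʳ m)
∑-∣p∩fibre∣ g (outside ∷ p) = ∑-∣p∩fibre∣ (λ x → g (fsuc x)) p
∑-∣p∩fibre∣ g (inside  ∷ p) =
  trans (∑-∣does∷∣ (g fzero) (λ c → p ∩ fibre (λ x → g (fsuc x)) c))
        (cong suc (∑-∣p∩fibre∣ (λ x → g (fsuc x)) p))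

-- Residues and cyclic indices

[m+n]%o≡m%o⇒o∣n : ∀ m n o .{{_ : NonZero o}} → (m + n) % o ≡ m % o → o ∣ n
[m+n]%o≡m%o⇒o∣n m n o eq = ∣m+n∣m⇒∣n (divides ((m + n) / o) q*o+n≡q′*o) (n∣m*n (m / o))
  where
  open ≡-Reasoning
  q*o+n≡q′*o : m / o * o + n ≡ (m + n) / o * o
  q*o+n≡q′*o = +-cancelˡ-≡ (m % o) _ _ (begin
    m % o + (m / o * o + n)       ≡⟨ +-assoc (m % o) _ n ⟨
    m % o + m / o * o + n         ≡⟨ cong (_+ n) (m≡m%n+[m/n]*n m o) ⟨
    m + n                         ≡⟨ m≡m%n+[m/n]*n (m + n) o ⟩
    (m + n) % o + (m + n) / o * o ≡⟨ cong (_+ (m + n) / o * o) eq ⟩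
    m % o + (m + n) / o * o       ∎)

[m+n]%o≡m%o⇒n≡0 : ∀ m {n o} .{{_ : NonZero o}} → n < o → (m + n) % o ≡ m % o → n ≡ 0
[m+n]%o≡m%o⇒n≡0 m {zero}      _   _  = refl
[m+n]%o≡m%o⇒n≡0 m {suc n} {o} n<o eq =
  contradiction (∣⇒≤ ([m+n]%o≡m%o⇒o∣n m (suc n) o eq)) (<⇒≱ n<o)

%-congˡ-+ : ∀ {x y} r o .{{_ : NonZero o}} → x % o ≡ y % o → (x + r) % o ≡ (y + r) % o
%-congˡ-+ {x} {y} r o eq = begin
  (x + r) % o         ≡⟨ %-distribˡ-+ x r o ⟩
  (x % o + r % o) % o ≡⟨ cong (λ z → (z + r % o) % o) eq ⟩
  (y % o + r % o) % o ≡⟨ %-distribˡ-+ y r o ⟨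
  (y + r) % o         ∎
  where open ≡-Reasoning

%-cancelˡ-+ : ∀ b {x y o} .{{_ : NonZero o}} → x < o → y < o →
              (b + x) % o ≡ (b + y) % o → x ≡ y
%-cancelˡ-+ b {x} {y} x<o y<o eq =
  [ (λ x≤y → cancel x≤y y<o eq) , (λ y≤x → sym (cancel y≤x x<o (sym eq))) ]′ (≤-total x y)
  where
  cancel : ∀ {x y o} .{{_ : NonZero o}} → x ≤ y → y < o → (b + x) % o ≡ (b + y) % o → x ≡ y
  cancel {x} {y} {o} x≤y y<o eq = begin
    x           ≡⟨ +-identityʳ x ⟨
    x + 0       ≡⟨ cong (x +_) y∸x≡0 ⟨
    x + (y ∸ x) ≡⟨ m+[n∸m]≡n x≤y ⟩
    y           ∎
    where
    open ≡-Reasoning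
    y∸x≡0 : y ∸ x ≡ 0
    y∸x≡0 = [m+n]%o≡m%o⇒n≡0 (b + x) (≤-<-trans (m∸n≤m y x) y<o) (begin
      (b + x + (y ∸ x)) % o   ≡⟨ cong (_% o) (+-assoc b x (y ∸ x)) ⟩
      (b + (x + (y ∸ x))) % o ≡⟨ cong (λ z → (b + z) % o) (m+[n∸m]≡n x≤y) ⟩
      (b + y) % o             ≡⟨ eq ⟨
      (b + x) % o             ∎)

%≡⇒mod≡ : ∀ {x y o} .{{_ : NonZero o}} → x % o ≡ y % o → x mod o ≡ y mod o
%≡⇒mod≡ eq = toℕ-injective (trans (toℕ-fromℕ< _) (trans eq (sym (toℕ-fromℕ< _))))

mod≡⇒%≡ : ∀ {x y o} .{{_ : NonZero o}} → x mod o ≡ y mod o → x % o ≡ y % o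
mod≡⇒%≡ eq = trans (sym (toℕ-fromℕ< _)) (trans (cong toℕ eq) (toℕ-fromℕ< _))

suc-%-% : ∀ x o .{{_ : NonZero o}} → suc (x % o) % o ≡ suc x % o
suc-%-% x o = begin
  (1 + x % o) % o         ≡⟨ %-distribˡ-+ 1 (x % o) o ⟩
  (1 % o + x % o % o) % o ≡⟨ cong (λ z → (1 % o + z) % o) (m%n%n≡m%n x o) ⟩
  (1 % o + x % o) % o     ≡⟨ %-distribˡ-+ 1 x o ⟨
  (1 + x) % o             ∎
  where open ≡-Reasoning

prev : ∀ {m} → Fin m → Fin m
prev {suc m₁} fzero = fromℕ m₁
prev (fsuc i)       = inject₁ i

module _ {m₁ : ℕ} where

  shift : ℕ → Fin (suc m₁) → Fin (suc m₁)
  shift d i = (d + toℕ i) mod suc m₁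

  next-shift : ∀ d i → next (shift d i) ≡ shift (suc d) i
  next-shift d i = %≡⇒mod≡ {suc (toℕ (shift d i))} {suc d + toℕ i}
    (trans (cong (λ z → suc z % suc m₁) (toℕ-fromℕ< _)) (suc-%-% (d + toℕ i) (suc m₁)))

  shift-≢ : ∀ {d} i → 0 < d → d < suc m₁ → shift d i ≢ i
  shift-≢ {d} i 0<d d<m eq = <⇒≢ 0<d (sym ([m+n]%o≡m%o⇒n≡0 (toℕ i) d<m (begin
    (toℕ i + d) % suc m₁ ≡⟨ cong (_% suc m₁) (+-comm (toℕ i) d) ⟩
    (d + toℕ i) % suc m₁ ≡⟨ toℕ-fromℕ< _ ⟨
    toℕ (shift d i)      ≡⟨ cong toℕ eq ⟩
    toℕ i                ≡⟨ m<n⇒m%n≡m (toℕ<n i) ⟨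
    toℕ i % suc m₁       ∎)))
    where open ≡-Reasoning

  next-injective : ∀ {i j : Fin (suc m₁)} → next i ≡ next j → i ≡ j
  next-injective {i} {j} eq =
    toℕ-injective (%-cancelˡ-+ 1 (toℕ<n i) (toℕ<n j) (mod≡⇒%≡ {1 + toℕ i} {1 + toℕ j} eq))

  next-prev : ∀ (i : Fin (suc m₁)) → next (prev i) ≡ i
  next-prev fzero    = toℕ-injective (trans (toℕ-fromℕ< _)
    (trans (cong (λ z → suc z % suc m₁) (toℕ-fromℕ m₁)) (n%n≡0 (suc m₁))))
  next-prev (fsuc i) = toℕ-injective (trans (toℕ-fromℕ< _)
    (trans (cong (λ z → suc z % suc m₁) (toℕ-inject₁ i)) (m<n⇒m%n≡m (s≤s (toℕ<n i)))))

  prev-next : ∀ (i : Fin (suc m₁)) → prev (next i) ≡ i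
  prev-next i = next-injective (next-prev (next i))

  toℕ-mod : ∀ (i : Fin (suc m₁)) → toℕ i mod suc m₁ ≡ i
  toℕ-mod i = toℕ-injective (trans (toℕ-fromℕ< _) (m<n⇒m%n≡m (toℕ<n i)))

  mod-next : ∀ j → next (j mod suc m₁) ≡ suc j mod suc m₁
  mod-next j = %≡⇒mod≡ {suc (toℕ (j mod suc m₁))} {suc j}
    (trans (cong (λ z → suc z % suc m₁) (toℕ-fromℕ< _)) (suc-%-% j (suc m₁)))

  ∑-rotate : ∀ (f : Fin (suc m₁) → ℕ) → ∑[ i < suc m₁ ] f (next i) ≡ ∑[ i < suc m₁ ] f i
  ∑-rotate f = begin
    ∑[ i < suc m₁ ] f (next i)                             ≡⟨ sum-init-last (λ i → f (next i)) ⟩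
    ∑[ i < m₁ ] f (next (inject₁ i)) + f (next (fromℕ m₁)) ≡⟨ cong₂ _+_ sum-next-inject₁ (cong f (next-prev fzero)) ⟩
    ∑[ i < m₁ ] f (fsuc i) + f fzero                       ≡⟨ +-comm _ (f fzero) ⟩
    ∑[ i < suc m₁ ] f i                                    ∎
    where
    open ≡-Reasoning
    sum-next-inject₁ : ∑[ i < m₁ ] f (next (inject₁ i)) ≡ ∑[ i < m₁ ] f (fsuc i)
    sum-next-inject₁ = sum-cong-≗ (λ i → cong f (next-prev (fsuc i)))

  ∑≤[m/2] : ∀ (f : Fin (suc m₁) → ℕ) → (∀ k → f k + f (next k) ≤ 1) →
            ∑[ k < suc m₁ ] f k ≤ suc m₁ / 2
  ∑≤[m/2] f pair = begin
    s         ≡⟨ m*n/n≡m s 2 ⟨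
    s * 2 / 2 ≤⟨ /-monoˡ-≤ 2 s*2≤m ⟩
    suc m₁ / 2 ∎
    where
    open ≤-Reasoning
    s = ∑[ k < suc m₁ ] f k
    s*2≤m : s * 2 ≤ suc m₁
    s*2≤m = begin
      s * 2                              ≡⟨ *-comm s 2 ⟩
      s + (s + 0)                        ≡⟨ cong (s +_) (trans (+-identityʳ s) (sym (∑-rotate f))) ⟩
      s + ∑[ k < suc m₁ ] f (next k)     ≡⟨ ∑-distrib-+ f (λ k → f (next k)) ⟨
      ∑[ k < suc m₁ ] (f k + f (next k)) ≤⟨ ∑-mono-≤ pair ⟩
      ∑[ k < suc m₁ ] 1                  ≡⟨ trans (∑-const (suc m₁) 1) (*-identityʳ (suc m₁)) ⟩
      suc m₁                             ∎

-- Arcs on a circle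

module ArcSequence (m : ℕ) (A : ℕ → ℕ) (A-pair : ∀ j → A j + A (suc j) ≤ m) where

  NonOverlapping : (ℕ → ℕ) → Set
  NonOverlapping p = ∀ j → p j + A j ≤ p (suc j) × p (suc j) + A (suc j) ≤ p j + m

  ⊓-nonOverlapping : ∀ {p q} → NonOverlapping p → NonOverlapping q →
                     NonOverlapping (λ j → p j ⊓ q j)
  ⊓-nonOverlapping {p} {q} p-ok q-ok j =
    ≤-trans (≤-reflexive (+-distribʳ-⊓ (A j) (p j) (q j)))
            (⊓-mono-≤ (proj₁ (p-ok j)) (proj₁ (q-ok j))) ,
    ≤-trans (≤-reflexive (+-distribʳ-⊓ (A (suc j)) (p (suc j)) (q (suc j))))
            (≤-trans (⊓-mono-≤ (proj₂ (p-ok j)) (proj₂ (q-ok j)))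
                     (≤-reflexive (sym (+-distribʳ-⊓ m (p j) (q j)))))

  +-nonOverlapping : ∀ {p} c → NonOverlapping p → NonOverlapping (λ j → p j + c)
  +-nonOverlapping {p} c p-ok j =
    ≤-trans (≤-reflexive (xy∙z≈xz∙y (p j) c (A j))) (+-monoˡ-≤ c (proj₁ (p-ok j))) ,
    ≤-trans (≤-reflexive (xy∙z≈xz∙y (p (suc j)) c (A (suc j))))
            (≤-trans (+-monoˡ-≤ c (proj₂ (p-ok j))) (≤-reflexive (xy∙z≈xz∙y (p j) m c)))

  A≤m : ∀ j → A (suc j) ≤ m
  A≤m j = m+n≤o⇒n≤o (A j) (A-pair j)

  packed : ℕ → ℕ
  packed zero    = 0
  packed (suc j) = packed j + A j

  packed-nonOverlapping : NonOverlapping packed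
  packed-nonOverlapping j =
    ≤-refl ,
    ≤-trans (≤-reflexive (+-assoc (packed j) (A j) (A (suc j)))) (+-monoʳ-≤ (packed j) (A-pair j))

  packed-∑ : ∀ j → packed j ≡ ∑[ i < j ] A (toℕ i)
  packed-∑ zero    = refl
  packed-∑ (suc j) = begin
    packed j + A j                                     ≡⟨ cong₂ _+_ (packed-∑ j) (cong A (sym (toℕ-fromℕ j))) ⟩
    ∑[ i < j ] A (toℕ i) + A (toℕ (fromℕ j))           ≡⟨ cong (_+ A (toℕ (fromℕ j))) sum-inject₁ ⟨
    ∑[ i < j ] A (toℕ (inject₁ i)) + A (toℕ (fromℕ j)) ≡⟨ sum-init-last (λ i → A (toℕ i)) ⟨
    ∑[ i < suc j ] A (toℕ i)                           ∎
    where
    open ≡-Reasoning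
    sum-inject₁ : ∑[ i < j ] A (toℕ (inject₁ i)) ≡ ∑[ i < j ] A (toℕ i)
    sum-inject₁ = sum-cong-≗ {j} (λ i → cong A (toℕ-inject₁ i))

  spread : ℕ → ℕ
  spread zero    = 0
  spread (suc j) = spread j + (m ∸ A (suc j))

  spread-nonOverlapping : NonOverlapping spread
  spread-nonOverlapping j =
    +-monoʳ-≤ (spread j) (m+n≤o⇒m≤o∸n (A j) (A-pair j)) ,
    ≤-reflexive (trans (+-assoc (spread j) _ (A (suc j))) (cong (spread j +_) (m∸n+n≡m (A≤m j))))

  spread-mono : ∀ {j k} → j ≤ k → spread j ≤ spread k
  spread-mono {k = zero}  z≤n = z≤n
  spread-mono {j} {suc k} j≤1+k with m≤n⇒m<n∨m≡n j≤1+k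
  ... | inj₁ (s≤s j≤k) = ≤-trans (spread-mono j≤k) (m≤m+n (spread k) _)
  ... | inj₂ refl      = ≤-refl

  m≤spread-step² : ∀ j → m ≤ (m ∸ A (suc j)) + (m ∸ A (suc (suc j)))
  m≤spread-step² j = begin
    m                                       ≡⟨ m∸n+n≡m (A≤m j) ⟨
    (m ∸ A (suc j)) + A (suc j)             ≤⟨ +-monoʳ-≤ (m ∸ A (suc j)) A≤m∸A ⟩
    (m ∸ A (suc j)) + (m ∸ A (suc (suc j))) ∎
    where
    open ≤-Reasoning
    A≤m∸A : A (suc j) ≤ m ∸ A (suc (suc j))
    A≤m∸A = m+n≤o⇒m≤o∸n (A (suc j)) (A-pair (suc j))

  k*m≤spread[k*2] : ∀ k → k * m ≤ spread (k * 2)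
  k*m≤spread[k*2] zero    = z≤n
  k*m≤spread[k*2] (suc k) = begin
    m + k * m                  ≡⟨ +-comm m (k * m) ⟩
    k * m + m                  ≤⟨ +-mono-≤ (k*m≤spread[k*2] k) (m≤spread-step² (k * 2)) ⟩
    spread (k * 2) + _         ≡⟨ +-assoc (spread (k * 2)) _ _ ⟨
    spread (suc (suc (k * 2))) ∎
    where open ≤-Reasoning

  m*[m/2]≤spread : m * (m / 2) ≤ spread m
  m*[m/2]≤spread = begin
    m * (m / 2)        ≡⟨ *-comm m (m / 2) ⟩
    m / 2 * m          ≤⟨ k*m≤spread[k*2] (m / 2) ⟩
    spread (m / 2 * 2) ≤⟨ spread-mono (m/n*n≤m m 2) ⟩
    spread m           ∎
    where open ≤-Reasoning

  -- Minimum of the loosest placement and of the tightest one translated to end at T.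
  arcStart : ℕ → ℕ → ℕ
  arcStart T j = spread j ⊓ (packed j + (T ∸ packed m))

  arcStart-nonOverlapping : ∀ T → NonOverlapping (arcStart T)
  arcStart-nonOverlapping T =
    ⊓-nonOverlapping spread-nonOverlapping (+-nonOverlapping (T ∸ packed m) packed-nonOverlapping)

  arcStart-m : ∀ {T} → packed m ≤ T → T ≤ spread m → arcStart T m ≡ T
  arcStart-m packed≤T T≤spread =
    trans (cong (spread m ⊓_) (m+[n∸m]≡n packed≤T)) (m≥n⇒m⊓n≡n T≤spread)

-- Arc k consists of the a k colours from start k on (mod m); arc (next k) begins gap k colours
-- after start k.
record CyclicArcs {m₁ : ℕ} (a : Fin (suc m₁) → ℕ) : Set where
  field
    start gap  : Fin (suc m₁) → ℕ
    a≤gap      : ∀ k → a k ≤ gap k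
    gap+a≤m    : ∀ k → gap k + a (next k) ≤ suc m₁
    start-next : ∀ k → start (next k) % suc m₁ ≡ (start k + gap k) % suc m₁

cyclicArcs : ∀ {m₁} (a : Fin (suc m₁) → ℕ) → (∀ k → a k + a (next k) ≤ suc m₁) →
             ∑[ k < suc m₁ ] a k ≤ suc m₁ * (suc m₁ / 2) → CyclicArcs a
cyclicArcs {m₁} a a-pair ∑a≤T = record
  { start      = λ k → p (toℕ k)
  ; gap        = λ k → p (suc (toℕ k)) ∸ p (toℕ k)
  ; a≤gap      = λ k → subst (_≤ p (suc (toℕ k)) ∸ p (toℕ k)) (cong a (toℕ-mod k)) (A≤gap (toℕ k))
  ; gap+a≤m    = λ k → gap+A≤m (toℕ k)
  ; start-next = λ k → trans (cong (λ j → p j % m) (toℕ-fromℕ< {m = suc (toℕ k) % m} {n = m} _))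
                         (trans (p-wrap (toℕ<n k)) (cong (_% m) (sym (m+[n∸m]≡n (p-step (toℕ k))))))
  }
  where
  m = suc m₁
  T = m * (m / 2)
  A : ℕ → ℕ
  A j = a (j mod m)
  open ArcSequence m A (λ j → subst (λ k → A j + a k ≤ m) (mod-next j) (a-pair (j mod m)))
  packed≤T : packed m ≤ T
  packed≤T = subst (_≤ T) (sym (trans (packed-∑ m) (sum-cong-≗ (λ i → cong a (toℕ-mod i))))) ∑a≤T
  p : ℕ → ℕ
  p = arcStart T
  p-ok : NonOverlapping p
  p-ok = arcStart-nonOverlapping T
  p-step : ∀ j → p j ≤ p (suc j)
  p-step j = m+n≤o⇒m≤o (p j) (proj₁ (p-ok j))
  A≤gap : ∀ j → A j ≤ p (suc j) ∸ p j
  A≤gap j = m+n≤o⇒m≤o∸n (A j) (subst (_≤ p (suc j)) (+-comm (p j) (A j)) (proj₁ (p-ok j)))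
  gap+A≤m : ∀ j → (p (suc j) ∸ p j) + A (suc j) ≤ m
  gap+A≤m j = begin
    (p (suc j) ∸ p j) + A (suc j) ≡⟨ +-∸-comm (A (suc j)) (p-step j) ⟨
    (p (suc j) + A (suc j)) ∸ p j ≤⟨ ∸-monoˡ-≤ (p j) (proj₂ (p-ok j)) ⟩
    (p j + m) ∸ p j               ≡⟨ m+n∸m≡n (p j) m ⟩
    m                             ∎
    where open ≤-Reasoning
  p-wrap : ∀ {j} → j < m → p (suc j % m) % m ≡ p (suc j) % m
  p-wrap {j} j<m with m≤n⇒m<n∨m≡n j<m
  ... | inj₁ 1+j<m = cong (λ i → p i % m) (m<n⇒m%n≡m 1+j<m)
  ... | inj₂ refl  = begin
    p (m % m) % m   ≡⟨ cong (λ i → p i % m) (n%n≡0 m) ⟩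
    p 0 % m         ≡⟨⟩
    0               ≡⟨ m*n%n≡0 (m / 2) m ⟨
    (m / 2 * m) % m ≡⟨ cong (_% m) (*-comm (m / 2) m) ⟩
    T % m           ≡⟨ cong (_% m) (arcStart-m packed≤T m*[m/2]≤spread) ⟨
    p m % m         ∎
    where open ≡-Reasoning

-- The increasing bijection from ℕ onto ℕ ∖ [d, d + c).
skip : ℕ → ℕ → ℕ → ℕ
skip d c x with x <? d
... | yes _ = x
... | no  _ = x + c

skip-≥ : ∀ d c x → x ≤ skip d c x
skip-≥ d c x with x <? d
... | yes _ = ≤-refl
... | no  _ = m≤m+n x c

skip-≤ : ∀ d c x → skip d c x ≤ x + c
skip-≤ d c x with x <? d
... | yes _ = m≤m+n x c
... | no  _ = ≤-refl

skip-∉ : ∀ d c x → skip d c x < d ⊎ d + c ≤ skip d c x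
skip-∉ d c x with x <? d
... | yes x<d = inj₁ x<d
... | no  x≮d = inj₂ (+-monoˡ-≤ c (≮⇒≥ x≮d))

skip-injective : ∀ d c {x y} → skip d c x ≡ skip d c y → x ≡ y
skip-injective d c {x} {y} eq with x <? d | y <? d
... | yes _   | yes _   = eq
... | no  _   | no  _   = +-cancelʳ-≡ c x y eq
... | yes x<d | no  y≮d =
  contradiction (≤-trans (≮⇒≥ y≮d) (≤-trans (m≤m+n y c) (≤-reflexive (sym eq)))) (<⇒≱ x<d)
... | no  x≮d | yes y<d =
  contradiction (≤-trans (≮⇒≥ x≮d) (≤-trans (m≤m+n x c) (≤-reflexive eq))) (<⇒≱ y<d)

-- Colourings of families of cliques

colorable-from-local : ∀ {m n k} (φ : Cliques m n) (colour : Fin m → Fin n → Fin k) →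
                       (∀ i {u v} → u ∈ φ i → v ∈ φ i → colour i u ≡ colour i v → u ≡ v) →
                       (∀ i j {v} → v ∈ φ i → v ∈ φ j → colour i v ≡ colour j v) →
                       Colorable k φ
colorable-from-local φ colour injective agree =
  (λ v (i , _) → colour i v) ,
  λ { u v (i , u∈i) (j , v∈j) (u≢v , l , u∈l , v∈l) eq →
        u≢v (injective l u∈l v∈l (trans (agree l i u∈l u∈i) (trans eq (agree j l v∈j v∈l)))) }

colorable⇒cliqueInjective : ∀ {m n k} (φ : Cliques m n) → Colorable (suc k) φ →
                            Σ (Fin n → Fin (suc k)) λ g →
                              ∀ i {u v} → u ∈ φ i → v ∈ φ i → g u ≡ g v → u ≡ v
colorable⇒cliqueInjective {n = n} {k} φ (c , proper) = g , injective
  where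
  g : Fin n → Fin (suc k)
  g v with any? (λ i → v ∈? φ i)
  ... | yes v∈φ = c v v∈φ
  ... | no  _   = fzero
  g-spec : ∀ {i v} → v ∈ φ i → Σ (InGraph φ v) λ w → g v ≡ c v w
  g-spec {i} {v} v∈φi with any? (λ i → v ∈? φ i)
  ... | yes w   = w , refl
  ... | no  v∉φ = ⊥-elim (v∉φ (i , v∈φi))
  injective : ∀ i {u v} → u ∈ φ i → v ∈ φ i → g u ≡ g v → u ≡ v
  injective i {u} {v} u∈i v∈i gu≡gv with u ≟ v
  ... | yes u≡v = u≡v
  ... | no  u≢v with g-spec u∈i | g-spec v∈i
  ...   | wu , gu≡ | wv , gv≡ =
    ⊥-elim (proper u v wu wv (u≢v , i , u∈i , v∈i) (trans (sym gu≡) (trans gu≡gv gv≡)))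

-- Clique holes

module CliqueHole {m₁ n : ℕ} (4≤m : 4 ≤ suc m₁) (φ : Cliques (suc m₁) n)
                  (hole : IsCliqueHole (suc m₁) φ) where

  private
    m : ℕ
    m = suc m₁

  meet⇒adjacent : ∀ {i j v} → i ≢ j → v ∈ φ i → v ∈ φ j → j ≡ next i ⊎ i ≡ next j
  meet⇒adjacent i≢j v∈i v∈j =
    Equivalence.to (proj₂ (proj₂ (proj₂ hole)) _ _ i≢j) (_ , x∈p∩q⁺ (v∈i , v∈j))

  ∣φ∣≤m : ∀ i → ∣ φ i ∣ ≤ m
  ∣φ∣≤m = proj₁ (proj₂ (proj₂ hole))

  next≢ : ∀ k → next k ≢ k
  next≢ k = shift-≢ k (s≤s z≤n) (≤-trans (s≤s (s≤s z≤n)) 4≤m)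

  next²≢ : ∀ k → next (next k) ≢ k
  next²≢ k eq = shift-≢ k (s≤s z≤n) (≤-trans (s≤s (s≤s (s≤s z≤n))) 4≤m)
                  (trans (sym (next-shift 1 k)) eq)

  next³≢ : ∀ k → next (next (next k)) ≢ k
  next³≢ k eq = shift-≢ k (s≤s z≤n) 4≤m
                  (trans (sym (trans (cong next (next-shift 1 k)) (next-shift 2 k))) eq)

  ∉φ-next² : ∀ {k v} → v ∈ φ k → v ∉ φ (next (next k))
  ∉φ-next² {k} v∈k v∈k″ with meet⇒adjacent (λ eq → next²≢ k (sym eq)) v∈k v∈k″
  ... | inj₁ eq = next≢ (next k) eq
  ... | inj₂ eq = next³≢ k (sym eq)

  shared : Fin m → Subset n
  shared k = φ k ∩ φ (next k)

  shared⊆φ : ∀ {k} → shared k ⊆ φ k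
  shared⊆φ {k} = p∩q⊆p (φ k) (φ (next k))

  shared⊆φ-next : ∀ {k} → shared k ⊆ φ (next k)
  shared⊆φ-next {k} = p∩q⊆q (φ k) (φ (next k))

  shared-disjoint-next : ∀ {k v} → v ∈ shared k → v ∉ shared (next k)
  shared-disjoint-next v∈k v∈k′ = ∉φ-next² (shared⊆φ v∈k) (shared⊆φ-next v∈k′)

  a : Fin m → ℕ
  a k = ∣ shared k ∣

  a-pair : ∀ k → a k + a (next k) ≤ m
  a-pair k = ≤-trans (∣p∣+∣q∣≤∣r∣ shared-disjoint-next shared⊆φ-next shared⊆φ) (∣φ∣≤m (next k))

  intersectionSum≡∑a : intersectionSum φ ≡ ∑[ k < m ] a k
  intersectionSum≡∑a = sum-map-tabulate a (λ k → k)

  ∑a≤m*[m/2] : (g : Fin n → Fin m) → (∀ i {u v} → u ∈ φ i → v ∈ φ i → g u ≡ g v → u ≡ v) →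
               ∑[ k < m ] a k ≤ m * (m / 2)
  ∑a≤m*[m/2] g injective = begin
    ∑[ k < m ] a k                                 ≡⟨ sum-cong-≗ (λ k → ∑-∣p∩fibre∣ g (shared k)) ⟨
    ∑[ k < m ] ∑[ c < m ] ∣ shared k ∩ fibre g c ∣ ≡⟨ ∑-comm (λ k c → ∣ shared k ∩ fibre g c ∣) ⟩
    ∑[ c < m ] ∑[ k < m ] ∣ shared k ∩ fibre g c ∣ ≤⟨ ∑-mono-≤ (λ c → ∑≤[m/2] (count c) (colour-pair c)) ⟩
    ∑[ c < m ] (m / 2)                             ≡⟨ ∑-const m (m / 2) ⟩
    m * (m / 2)                                    ∎
    where
    open ≤-Reasoning
    count : Fin m → Fin m → ℕ
    count c k = ∣ shared k ∩ fibre g c ∣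
    colour-pair : ∀ c k → count c k + count c (next k) ≤ 1
    colour-pair c k = ≤-trans
      (∣p∣+∣q∣≤∣r∣ (λ x∈k x∈k′ → shared-disjoint-next (p∩q⊆p _ _ x∈k) (p∩q⊆p _ _ x∈k′))
                   (∩-monoˡ-⊆ (fibre g c) shared⊆φ-next) (∩-monoˡ-⊆ (fibre g c) shared⊆φ))
      (∣p∣≤1 λ x∈ y∈ → injective (next k) (p∩q⊆p _ _ x∈) (p∩q⊆p _ _ y∈)
        (trans (∈fibre⁻ {g = g} (p∩q⊆q _ _ x∈)) (sym (∈fibre⁻ {g = g} (p∩q⊆q _ _ y∈)))))

  module ArcColouring (arcs : CyclicArcs a) where
    open CyclicArcs arcs

    exclusive : Fin m → Subset n
    exclusive j = φ j ∩ ∁ (φ (prev j) ∪ φ (next j))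

    shared-prev⊆φ : ∀ {j} → shared (prev j) ⊆ φ j
    shared-prev⊆φ {j} {v} v∈ = subst (λ i → v ∈ φ i) (next-prev j) (shared⊆φ-next v∈)

    shared-prev-disjoint : ∀ {j v} → v ∈ shared (prev j) → v ∉ shared j
    shared-prev-disjoint {j} {v} v∈ = subst (λ i → v ∉ shared i) (next-prev j) (shared-disjoint-next v∈)

    ∣exclusive∣+a+a≤m : ∀ j → ∣ exclusive j ∣ + (a (prev j) + a j) ≤ m
    ∣exclusive∣+a+a≤m j = begin
      ∣ exclusive j ∣ + (a (prev j) + a j)             ≡⟨ cong (∣ exclusive j ∣ +_) ∣boundary∣ ⟨
      ∣ exclusive j ∣ + ∣ shared (prev j) ∪ shared j ∣ ≤⟨ ∣p∣+∣q∣≤∣r∣ exclusive-disjoint (p∩q⊆p _ _) boundary⊆φ ⟩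
      ∣ φ j ∣                                          ≤⟨ ∣φ∣≤m j ⟩
      m                                                ∎
      where
      open ≤-Reasoning
      ∣boundary∣ : ∣ shared (prev j) ∪ shared j ∣ ≡ a (prev j) + a j
      ∣boundary∣ = ∣p∪q∣≡∣p∣+∣q∣ shared-prev-disjoint
      boundary⊆φ : shared (prev j) ∪ shared j ⊆ φ j
      boundary⊆φ x∈ = [ shared-prev⊆φ , shared⊆φ ]′ (x∈p∪q⁻ _ _ x∈)
      exclusive-disjoint : ∀ {x} → x ∈ exclusive j → x ∉ shared (prev j) ∪ shared j
      exclusive-disjoint x∈exclusive x∈ = x∈∁p⇒x∉p (p∩q⊆q _ _ x∈exclusive)
        (x∈p∪q⁺ (Sum.map shared⊆φ shared⊆φ-next (x∈p∪q⁻ _ _ x∈)))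

    gap-prev+a≤m : ∀ j → gap (prev j) + a j ≤ m
    gap-prev+a≤m j = subst (λ i → gap (prev j) + a i ≤ m) (next-prev j) (gap+a≤m (prev j))

    -- Vertex v of Φ j gets the colour start (prev j) + offset j v: shared (prev j) takes the
    -- offsets [0, a (prev j)), shared j takes [gap (prev j), gap (prev j) + a j), and the
    -- exclusive vertices take the remaining offsets from a (prev j) on, in order.
    offset : Fin m → Fin n → ℕ
    offset j v with v ∈? φ (prev j) | v ∈? φ (next j)
    ... | yes _ | _     = rank (shared (prev j)) v
    ... | no  _ | yes _ = gap (prev j) + rank (shared j) v
    ... | no  _ | no  _ = skip (gap (prev j)) (a j) (a (prev j) + rank (exclusive j) v)

    data Place (j : Fin m) (v : Fin n) : ℕ → Set where
      in-shared-prev : v ∈ shared (prev j) → Place j v (rank (shared (prev j)) v)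
      in-shared      : v ∈ shared j → Place j v (gap (prev j) + rank (shared j) v)
      in-exclusive   : v ∈ exclusive j →
                       Place j v (skip (gap (prev j)) (a j) (a (prev j) + rank (exclusive j) v))

    place : ∀ {j v} → v ∈ φ j → Place j v (offset j v)
    place {j} {v} v∈j with v ∈? φ (prev j) | v ∈? φ (next j)
    ... | yes v∈prev | _          =
      in-shared-prev (x∈p∩q⁺ (v∈prev , subst (λ i → v ∈ φ i) (sym (next-prev j)) v∈j))
    ... | no  _      | yes v∈next = in-shared (x∈p∩q⁺ (v∈j , v∈next))
    ... | no  v∉prev | no  v∉next =
      in-exclusive (x∈p∩q⁺ (v∈j , x∉p⇒x∈∁p (λ v∈∪ → [ v∉prev , v∉next ]′ (x∈p∪q⁻ _ _ v∈∪))))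

    place-< : ∀ {j v o} → Place j v o → o < m
    place-< {j} (in-shared-prev v∈) =
      <-≤-trans (rank-< v∈) (≤-trans (a≤gap (prev j)) (≤-trans (m≤m+n _ (a j)) (gap-prev+a≤m j)))
    place-< {j} (in-shared v∈) =
      <-≤-trans (+-monoʳ-< (gap (prev j)) (rank-< v∈)) (gap-prev+a≤m j)
    place-< {j} {v} (in-exclusive v∈) = begin-strict
      skip (gap (prev j)) (a j) (a (prev j) + r) ≤⟨ skip-≤ (gap (prev j)) (a j) _ ⟩
      a (prev j) + r + a j                       <⟨ +-monoˡ-< (a j) (+-monoʳ-< (a (prev j)) (rank-< v∈)) ⟩
      a (prev j) + ∣ exclusive j ∣ + a j         ≡⟨ cong (_+ a j) (+-comm (a (prev j)) _) ⟩
      ∣ exclusive j ∣ + a (prev j) + a j         ≡⟨ +-assoc ∣ exclusive j ∣ _ _ ⟩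
      ∣ exclusive j ∣ + (a (prev j) + a j)       ≤⟨ ∣exclusive∣+a+a≤m j ⟩
      m                                          ∎
      where
      open ≤-Reasoning
      r = rank (exclusive j) v

    place-injective : ∀ {j u v o o′} → Place j u o → Place j v o′ → o ≡ o′ → u ≡ v
    place-injective {j} = injective
      where
      b = a (prev j)
      d = gap (prev j)
      c = a j
      prev≢shared : ∀ {r s} → r < b → r ≢ d + s
      prev≢shared {r} {s} r<b eq =
        <⇒≱ r<b (≤-trans (a≤gap (prev j)) (≤-trans (m≤m+n d s) (≤-reflexive (sym eq))))
      prev≢exclusive : ∀ {r t} → r < b → r ≢ skip d c (b + t)
      prev≢exclusive {r} {t} r<b eq =
        <⇒≱ r<b (≤-trans (m≤m+n b t) (≤-trans (skip-≥ d c (b + t)) (≤-reflexive (sym eq))))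
      shared≢exclusive : ∀ {s x} → s < c → d + s ≢ skip d c x
      shared≢exclusive {s} {x} s<c eq with skip-∉ d c x
      ... | inj₁ <d   = <⇒≱ <d (≤-trans (m≤m+n d s) (≤-reflexive eq))
      ... | inj₂ d+c≤ = <⇒≱ (+-monoʳ-< d s<c) (≤-trans d+c≤ (≤-reflexive (sym eq)))
      injective : ∀ {u v o o′} → Place j u o → Place j v o′ → o ≡ o′ → u ≡ v
      injective (in-shared-prev u∈) (in-shared-prev v∈) eq = rank-injective u∈ v∈ eq
      injective (in-shared u∈)      (in-shared v∈)      eq =
        rank-injective u∈ v∈ (+-cancelˡ-≡ d _ _ eq)
      injective (in-exclusive u∈)   (in-exclusive v∈)   eq =
        rank-injective u∈ v∈ (+-cancelˡ-≡ b _ _ (skip-injective d c eq))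
      injective (in-shared-prev u∈) (in-shared _)       eq = ⊥-elim (prev≢shared (rank-< u∈) eq)
      injective (in-shared _)       (in-shared-prev v∈) eq = ⊥-elim (prev≢shared (rank-< v∈) (sym eq))
      injective (in-shared-prev u∈) (in-exclusive _)    eq = ⊥-elim (prev≢exclusive (rank-< u∈) eq)
      injective (in-exclusive _)    (in-shared-prev v∈) eq = ⊥-elim (prev≢exclusive (rank-< v∈) (sym eq))
      injective (in-shared u∈)      (in-exclusive _)    eq = ⊥-elim (shared≢exclusive (rank-< u∈) eq)
      injective (in-exclusive _)    (in-shared v∈)      eq = ⊥-elim (shared≢exclusive (rank-< v∈) (sym eq))

    colour : Fin m → Fin n → Fin m
    colour j v = (start (prev j) + offset j v) mod m

    colour-injective : ∀ j {u v} → u ∈ φ j → v ∈ φ j → colour j u ≡ colour j v → u ≡ v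
    colour-injective j {u} {v} u∈ v∈ eq =
      place-injective (place u∈) (place v∈)
        (%-cancelˡ-+ (start (prev j)) (place-< (place u∈)) (place-< (place v∈))
          (mod≡⇒%≡ {start (prev j) + offset j u} {start (prev j) + offset j v} eq))

    offset-shared : ∀ {k v} → v ∈ shared k → offset k v ≡ gap (prev k) + rank (shared k) v
    offset-shared {k} {v} v∈ with offset k v | place (shared⊆φ v∈)
    ... | _ | in-shared-prev v∈′     = ⊥-elim (shared-prev-disjoint v∈′ v∈)
    ... | _ | in-shared _            = refl
    ... | _ | in-exclusive v∈exclusive =
      ⊥-elim (x∈∁p⇒x∉p (p∩q⊆q _ _ v∈exclusive) (x∈p∪q⁺ (inj₂ (shared⊆φ-next v∈))))

    offset-shared-next : ∀ {k v} → v ∈ shared k → offset (next k) v ≡ rank (shared k) v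
    offset-shared-next {k} {v} v∈ with offset (next k) v | place (shared⊆φ-next v∈)
    ... | _ | in-shared-prev _       = cong (λ i → rank (shared i) v) (prev-next k)
    ... | _ | in-shared v∈′          = ⊥-elim (shared-disjoint-next v∈ v∈′)
    ... | _ | in-exclusive v∈exclusive =
      ⊥-elim (x∈∁p⇒x∉p (p∩q⊆q _ _ v∈exclusive)
        (x∈p∪q⁺ (inj₁ (subst (λ i → v ∈ φ i) (sym (prev-next k)) (shared⊆φ v∈)))))

    arcColour : Fin m → Fin n → Fin m
    arcColour k v = (start k + rank (shared k) v) mod m

    colour-shared : ∀ {k v} → v ∈ shared k → colour k v ≡ arcColour k v
    colour-shared {k} {v} v∈ = %≡⇒mod≡ {start (prev k) + offset k v} {start k + r} (begin
      (start (prev k) + offset k v) % m           ≡⟨ cong (λ o → (start (prev k) + o) % m) (offset-shared v∈) ⟩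
      (start (prev k) + (gap (prev k) + r)) % m   ≡⟨ cong (_% m) (+-assoc (start (prev k)) _ _) ⟨
      (start (prev k) + gap (prev k) + r) % m     ≡⟨ start-k+r ⟨
      (start k + r) % m                           ∎)
      where
      open ≡-Reasoning
      r = rank (shared k) v
      start-k : start k % m ≡ (start (prev k) + gap (prev k)) % m
      start-k = subst (λ i → start i % m ≡ (start (prev k) + gap (prev k)) % m) (next-prev k)
                      (start-next (prev k))
      start-k+r : (start k + r) % m ≡ (start (prev k) + gap (prev k) + r) % m
      start-k+r = %-congˡ-+ {start k} {start (prev k) + gap (prev k)} r m start-k

    colour-shared-next : ∀ {k v} → v ∈ shared k → colour (next k) v ≡ arcColour k v
    colour-shared-next {k} v∈ =
      cong₂ (λ s o → (s + o) mod m) (cong start (prev-next k)) (offset-shared-next v∈)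

    colour-agree : ∀ i j {v} → v ∈ φ i → v ∈ φ j → colour i v ≡ colour j v
    colour-agree i j v∈i v∈j with i ≟ j
    ... | yes refl = refl
    ... | no  i≢j with meet⇒adjacent i≢j v∈i v∈j
    ...   | inj₁ refl = trans (colour-shared v∈ij) (sym (colour-shared-next v∈ij))
      where v∈ij = x∈p∩q⁺ (v∈i , v∈j)
    ...   | inj₂ refl = trans (colour-shared-next v∈ji) (sym (colour-shared v∈ji))
      where v∈ji = x∈p∩q⁺ (v∈j , v∈i)

    colorable : Colorable m φ
    colorable = colorable-from-local φ colour colour-injective colour-agree

theorem2p1 : (m n : ℕ) → 4 ≤ m → (φ : Cliques m n) → IsCliqueHole m φ →
    (Colorable m φ ⇔ intersectionSum φ ≤ m * (m / 2))
theorem2p1 m@(suc _) n 4≤m φ hole = mk⇔ necessary sufficient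
  where
  open CliqueHole 4≤m φ hole
  necessary : Colorable m φ → intersectionSum φ ≤ m * (m / 2)
  necessary colouring =
    let g , g-injective = colorable⇒cliqueInjective φ colouring
    in subst (_≤ m * (m / 2)) (sym intersectionSum≡∑a) (∑a≤m*[m/2] g g-injective)
  sufficient : intersectionSum φ ≤ m * (m / 2) → Colorable m φ
  sufficient bound =
    ArcColouring.colorable (cyclicArcs a a-pair (subst (_≤ m * (m / 2)) intersectionSum≡∑a bound))
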